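{- Let $q\ge 2$, let $X$ be a finite set, and let $\mathcal C\subseteq \mathbb Z_q^X$ be a code in which every codeword has Hamming weight $w$. Suppose that: (C3) for each $i,j\in\{1,\dots,q-1\}$, the ordered pairs $(x,y)$ arising as $x,y\in X$, $x\neq y$, with $\mathsf u_x=i$, $\mathsf u_y=j$, $\mathsf u\in\mathcal C$, are all distinct (that is, no ordered pair $(x,y)$ arises in this way, for the same $(i,j)$, from two different codewords); (C4) for any distinct $\mathsf u,\mathsf v\in\mathcal C$, $|\mathrm{supp}(\mathsf u)\cap\mathrm{supp}(\mathsf v)|\le 2$. Then $\mathcal C$ has distance $2w-3$, i.e. $d(\mathsf u,\mathsf v)\ge 2w-3$ for all distinct $\mathsf u,\mathsf v\in\mathcal C$.
   Context: $\mathbb Z_q=\mathbb Z/q\mathbb Z$, and $\mathbb Z_q^X$ denotes vectors with entries in $\mathbb Z_q$ indexed by $X$. The support of $\mathsf u$ is $\mathrm{supp}(\mathsf u)=\{x\in X:\mathsf u_x\neq 0\}$, its Hamming weight is $|\mathrm{supp}(\mathsf u)|$, and the Hamming distance is $d(\mathsf u,\mathsf v)=|\mathrm{supp}(\mathsf u-\mathsf v)|$. -}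

module Defs where

open import Data.Nat using (ℕ)
open import Data.Fin using (Fin; zero)
open import Data.Fin.Subset using (Subset; ∣_∣; _∩_)
open import Data.Vec using (tabulate)
open import Data.Bool using (Bool; true; false; not)
open import Relation.Nullary using (¬_)
open import Relation.Nullary.Decidable using (⌊_⌋)
open import Relation.Binary.PropositionalEquality using (_≡_)
open import Data.Fin using (_≟_)

-- Words over ℤ_q indexed by a finite set X, identified with Fin n.
-- ℤ_q is represented by Fin q (with zero the additive identity).
Word : ℕ → ℕ → Set
Word n q = Fin n → Fin q

supp : ∀ {n q} → Word n (Data.Nat.suc q) → Subset n
supp u = tabulate (λ x → not ⌊ u x ≟ zero ⌋)

wt : ∀ {n q} → Word n (Data.Nat.suc q) → ℕ
wt u = ∣ supp u ∣

dist : ∀ {n q} → Word n q → Word n q → ℕ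
dist u v = ∣ tabulate (λ x → not ⌊ u x ≟ v x ⌋) ∣

-- distinct codewords (pointwise inequality, avoiding funext)
Distinct : ∀ {n q} → Word n q → Word n q → Set
Distinct u v = ¬ (∀ x → u x ≡ v x)

module Submission where

-- For words u, v over ℤ_q, classify each coordinate x by whether
-- u x, v x vanish and whether they agree.  A four-case check gives the pointwise
-- identity
--     [u x ≠ 0] + [v x ≠ 0] + [x is a clash] = [u x ≠ v x] + 2·[u x ≠ 0 ≠ v x],
-- where a clash is a coordinate in both supports on which u and v differ.
-- Summing over X yields the weight identity
--     wt u + wt v + #clashes = d(u,v) + 2·|supp u ∩ supp v| .
-- For distinct codewords, (C4) bounds the common support by 2, and when it has
-- exactly two points x ≠ y, condition (C3) forbids u and v to agree on both, so
-- there is a clash.  The identity then gives d(u,v) ≥ 2w − 3 by a small case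
-- analysis on the size of the common support.

open import Defs
open import Data.Nat using (ℕ; suc; _*_; _∸_; _≤_; _≥_)
open import Data.Fin using (Fin; zero)
open import Data.Fin.Subset using (∣_∣; _∩_)
open import Data.Product using (_×_)
open import Relation.Nullary using (¬_)
open import Relation.Binary.PropositionalEquality using (_≡_)

open import Data.Nat using (_+_; z≤n; s≤s; s≤s⁻¹)
open import Data.Nat.Properties
  using (+-*-semiring; ≤-trans; ≤-reflexive; +-comm; +-identityʳ; +-monoʳ-≤; m≤m+n; m≤n+m; n≤1+n; m≤n+o⇒m∸n≤o; module ≤-Reasoning)
open import Data.Fin using (_≟_) renaming (suc to fsuc)
open import Data.Fin.Properties using (suc-injective)
open import Data.Bool using (Bool; true; false; not; _∧_)
open import Data.Vec using (tabulate; _∷_)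
open import Data.Product using (Σ; _,_)
open import Data.Empty using (⊥; ⊥-elim)
open import Function using (_∘_)
open import Relation.Nullary using (yes; no)
open import Relation.Nullary.Decidable using (⌊_⌋)
open import Relation.Binary.PropositionalEquality using (refl; sym; trans; cong; cong₂; subst; module ≡-Reasoning)
open import Algebra.Properties.Semiring.Sum +-*-semiring using (sum; sum-cong-≗; ∑-distrib-+; *-distribˡ-sum)

ind : Bool → ℕ
ind true  = 1
ind false = 0

count : ∀ {n} → (Fin n → Bool) → ℕ
count f = sum (λ x → ind (f x))

card-tabulate : ∀ {n} (f : Fin n → Bool) → ∣ tabulate f ∣ ≡ count f
card-tabulate {ℕ.zero} f = refl
card-tabulate {suc n} f with f zero
... | true  = cong suc (card-tabulate (λ x → f (fsuc x)))
... | false = card-tabulate (λ x → f (fsuc x))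

∩-tabulate : ∀ {n} (f g : Fin n → Bool) →
             tabulate f ∩ tabulate g ≡ tabulate (λ x → f x ∧ g x)
∩-tabulate {ℕ.zero} f g = refl
∩-tabulate {suc n}  f g = cong (f zero ∧ g zero ∷_) (∩-tabulate (λ x → f (fsuc x)) (λ x → g (fsuc x)))

witness : ∀ {n} (f : Fin n → Bool) → 1 ≤ ∣ tabulate f ∣ → Σ (Fin n) λ x → f x ≡ true
witness {suc n} f h with f zero in eq
... | true  = zero , eq
... | false with witness (λ x → f (fsuc x)) h
...   | x , fx = fsuc x , fx

counted : ∀ {n} (f : Fin n → Bool) x → f x ≡ true → 1 ≤ ∣ tabulate f ∣
counted f x fx = subst (1 ≤_) (sym (card-tabulate f)) (go f x fx)
  where
  go : ∀ {n} (f : Fin n → Bool) x → f x ≡ true → 1 ≤ count f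
  go f zero     fx rewrite fx = s≤s z≤n
  go f (fsuc x) fx = ≤-trans (go (λ y → f (fsuc y)) x fx) (m≤n+m _ (ind (f zero)))

two-witnesses : ∀ {n} (f : Fin n → Bool) → 2 ≤ ∣ tabulate f ∣ →
                Σ (Fin n) λ x → Σ (Fin n) λ y → ¬ (x ≡ y) × f x ≡ true × f y ≡ true
two-witnesses {suc n} f h with f zero in eq
... | true with witness (λ x → f (fsuc x)) (s≤s⁻¹ h)
...   | y , fy = zero , fsuc y , (λ ()) , eq , fy
two-witnesses {suc n} f h | false with two-witnesses (λ x → f (fsuc x)) h
...   | x , y , x≢y , fx , fy = fsuc x , fsuc y , (λ e → x≢y (suc-injective e)) , fx , fy

module _ {n q : ℕ} (u v : Word n (suc q)) where

  nonzero-u nonzero-v differ common clash : Fin n → Bool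
  nonzero-u x = not ⌊ u x ≟ zero ⌋
  nonzero-v x = not ⌊ v x ≟ zero ⌋
  differ    x = not ⌊ u x ≟ v x ⌋
  common    x = nonzero-u x ∧ nonzero-v x
  clash     x = common x ∧ differ x

  common-support : supp u ∩ supp v ≡ tabulate common
  common-support = ∩-tabulate nonzero-u nonzero-v

  pointwise-identity : ∀ x → ind (nonzero-u x) + ind (nonzero-v x) + ind (clash x)
                             ≡ ind (differ x) + 2 * ind (common x)
  pointwise-identity x with u x ≟ zero | v x ≟ zero | u x ≟ v x
  ... | yes _  | yes _  | yes _  = refl
  ... | yes u0 | yes v0 | no u≢v = ⊥-elim (u≢v (trans u0 (sym v0)))
  ... | yes u0 | no v≢0 | yes uv = ⊥-elim (v≢0 (trans (sym uv) u0))
  ... | yes _  | no _   | no _   = refl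
  ... | no u≢0 | yes v0 | yes uv = ⊥-elim (u≢0 (trans uv v0))
  ... | no _   | yes _  | no _   = refl
  ... | no _   | no _   | yes _  = refl
  ... | no _   | no _   | no _   = refl

  weight-identity : wt u + wt v + ∣ tabulate clash ∣ ≡ dist u v + 2 * ∣ supp u ∩ supp v ∣
  weight-identity = begin
    wt u + wt v + ∣ tabulate clash ∣
      ≡⟨ cong₂ _+_ (cong₂ _+_ (card-tabulate nonzero-u) (card-tabulate nonzero-v)) (card-tabulate clash) ⟩
    count nonzero-u + count nonzero-v + count clash
      ≡⟨ cong (_+ count clash) (sym (∑-distrib-+ (ind ∘ nonzero-u) (ind ∘ nonzero-v))) ⟩
    sum (λ x → ind (nonzero-u x) + ind (nonzero-v x)) + count clash
      ≡⟨ sym (∑-distrib-+ (λ x → ind (nonzero-u x) + ind (nonzero-v x)) (ind ∘ clash)) ⟩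
    sum (λ x → ind (nonzero-u x) + ind (nonzero-v x) + ind (clash x))
      ≡⟨ sum-cong-≗ pointwise-identity ⟩
    sum (λ x → ind (differ x) + 2 * ind (common x))
      ≡⟨ ∑-distrib-+ (ind ∘ differ) (λ x → 2 * ind (common x)) ⟩
    count differ + sum (λ x → 2 * ind (common x))
      ≡⟨ cong (count differ +_) (sym (*-distribˡ-sum 2 (ind ∘ common))) ⟩
    count differ + 2 * count common
      ≡⟨ sym (cong₂ (λ d c → d + 2 * c) (card-tabulate differ)
                                         (trans (cong ∣_∣ common-support) (card-tabulate common))) ⟩
    dist u v + 2 * ∣ supp u ∩ supp v ∣ ∎
    where open ≡-Reasoning

  common⇒nonzero : ∀ x → common x ≡ true → ¬ u x ≡ zero
  common⇒nonzero x cx with u x ≟ zero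
  ... | no u≢0 = u≢0

  common⇒clash : ∀ x → common x ≡ true → ¬ u x ≡ v x → clash x ≡ true
  common⇒clash x cx u≢v rewrite cx with u x ≟ v x
  ... | yes u≡v = ⊥-elim (u≢v u≡v)
  ... | no _    = refl

  -- If u and v cannot agree on two distinct points of u's support (the content
  -- of (C3) for distinct codewords), a common support of size two has a clash.
  clash-exists : (∀ x y → ¬ x ≡ y → ¬ u x ≡ zero → ¬ u y ≡ zero → u x ≡ v x → u y ≡ v y → ⊥)
               → ∣ supp u ∩ supp v ∣ ≡ 2 → 1 ≤ ∣ tabulate clash ∣
  clash-exists rigid size-two
    with two-witnesses common (subst (2 ≤_) (cong ∣_∣ common-support) (≤-reflexive (sym size-two)))
  ... | x , y , x≢y , cx , cy with u x ≟ v x | u y ≟ v y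
  ...   | yes ux≡vx | yes uy≡vy = ⊥-elim (rigid x y x≢y (common⇒nonzero x cx) (common⇒nonzero y cy) ux≡vx uy≡vy)
  ...   | no ux≢vx  | _         = counted clash x (common⇒clash x cx ux≢vx)
  ...   | yes _     | no uy≢vy  = counted clash y (common⇒clash y cy uy≢vy)

sum-bound : ∀ {a c d s} → a + c ≡ d + 2 * s → s ≤ 2 → (s ≡ 2 → 1 ≤ c) → a ≤ 3 + d
sum-bound {a} {c} {d} eq z≤n _ = begin
  a      ≤⟨ m≤m+n a c ⟩
  a + c  ≡⟨ eq ⟩
  d + 0  ≡⟨ +-identityʳ d ⟩
  d      ≤⟨ m≤n+m d 3 ⟩
  3 + d  ∎
  where open ≤-Reasoning
sum-bound {a} {c} {d} eq (s≤s z≤n) _ = begin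
  a      ≤⟨ m≤m+n a c ⟩
  a + c  ≡⟨ eq ⟩
  d + 2  ≡⟨ +-comm d 2 ⟩
  2 + d  ≤⟨ n≤1+n (2 + d) ⟩
  3 + d  ∎
  where open ≤-Reasoning
sum-bound {a} {c} {d} eq (s≤s (s≤s z≤n)) c-positive = s≤s⁻¹ (begin
  suc a  ≡⟨ +-comm 1 a ⟩
  a + 1  ≤⟨ +-monoʳ-≤ a (c-positive refl) ⟩
  a + c  ≡⟨ eq ⟩
  d + 4  ≡⟨ +-comm d 4 ⟩
  4 + d  ∎)
  where open ≤-Reasoning

lemma4 : (q : ℕ) → 2 ≤ suc q → (n : ℕ) → (C : Word n (suc q) → Set) → (w : ℕ)
    → (∀ u → C u → wt u ≡ w)
    → (∀ u v → C u → C v → (x y : Fin n) → ¬ (x ≡ y) → (i j : Fin (suc q))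
        → ¬ (i ≡ zero) → ¬ (j ≡ zero)
        → u x ≡ i → u y ≡ j → v x ≡ i → v y ≡ j → ∀ z → u z ≡ v z)
    → (∀ u v → C u → C v → Distinct u v → ∣ supp u ∩ supp v ∣ ≤ 2)
    → ∀ u v → C u → C v → Distinct u v → dist u v ≥ 2 * w ∸ 3
lemma4 q _ n C w constant-weight C3 C4 u v cu cv u≉v =
  m≤n+o⇒m∸n≤o (2 * w) 3 (begin
    2 * w        ≡⟨ cong (w +_) (+-identityʳ w) ⟩
    w + w        ≡⟨ sym (cong₂ _+_ (constant-weight u cu) (constant-weight v cv)) ⟩
    wt u + wt v  ≤⟨ sum-bound (weight-identity u v) (C4 u v cu cv u≉v) (clash-exists u v no-double-agreement) ⟩
    3 + dist u v ∎)
  where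
  open ≤-Reasoning
  no-double-agreement : ∀ x y → ¬ x ≡ y → ¬ u x ≡ zero → ¬ u y ≡ zero → u x ≡ v x → u y ≡ v y → ⊥
  no-double-agreement x y x≢y ux≢0 uy≢0 ux≡vx uy≡vy =
    u≉v (C3 u v cu cv x y x≢y (u x) (u y) ux≢0 uy≢0 refl refl (sym ux≡vx) (sym uy≡vy))
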